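{- Let $P,Q\subseteq\mathbb{Z}^r$ be finite sets such that there is an invertible affine-linear transformation $\phi:\mathbb{Q}^r\to\mathbb{Q}^r$ with $\phi(P)=Q$. Then there is a constant $c=c_{P,Q}\in(0,1)$ such that $\mathsf{pdd}_Q(c\alpha)\le\mathsf{pdd}_P(\alpha)$ for all $0<\alpha<1$.
   Context: Let $[N]=\{1,\dots,N\}$. For a finite $P\subseteq\mathbb{Z}^r$ and $0<\alpha<1$, the popular difference density $\mathsf{pdd}_P(\alpha)$ is the largest real number such that for every $\epsilon>0$ there exists $N_0=N_0(P,\epsilon)$ such that for every $N\ge N_0$ and every $A\subseteq[N]^r$ with $|A|\ge\alpha N^r$ there is some nonzero integer $d$ with $|\{x\in\mathbb{Z}^r : x+dy\in A \text{ for all } y\in P\}|\ge(\mathsf{pdd}_P(\alpha)-\epsilon)N^r$.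
   Formalization: The parameter α and the tolerance ε in the definition of popular difference density range only over the rationals, and the constant c is taken in ℚ. -}

module Defs where

open import Data.Nat as ℕ using (ℕ; zero; suc)
open import Data.Integer as ℤ using (ℤ; +_)
open import Data.Rational as ℚ using (ℚ; 0ℚ; 1ℚ; _<_; _≤_; _-_)
open import Data.Bool using (Bool; true; false)
open import Data.List as List using (List; []; _∷_; upTo; concatMap; filterᵇ; length)
open import Data.Bool.ListAction using (and)
open import Data.List.NonEmpty as L⁺ using (List⁺; _∷_; toList)
open import Data.List.Membership.Propositional using (_∈_)
open import Data.Vec as Vec using (Vec; []; _∷_; zipWith; replicate; foldr)
open import Data.Fin using (Fin)
open import Data.Product using (Σ; ∃; _×_; _,_)
open import Relation.Binary.PropositionalEquality using (_≡_; _≢_)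

Pt : ℕ → Set
Pt r = Vec ℤ r

_⊕_ : ∀ {r} → Pt r → Pt r → Pt r
_⊕_ = zipWith ℤ._+_

_⊖_ : ∀ {r} → Pt r → Pt r → Pt r
_⊖_ = zipWith ℤ._-_

_⊙_ : ∀ {r} → ℤ → Pt r → Pt r
d ⊙ y = Vec.map (d ℤ.*_) y

box : ℕ → (r : ℕ) → List (Pt r)
box N zero = [] ∷ []
box N (suc r) = concatMap (λ k → List.map ((+ suc k) ∷_) (box N r)) (upTo N)

SubsetOfBox : ∀ {r} → ℕ → (Pt r → Bool) → Set
SubsetOfBox {r} N A = ∀ x → A x ≡ true → x ∈ box N r

card : ∀ {r} → ℕ → (Pt r → Bool) → ℕ
card {r} N A = length (filterᵇ A (box N r))

ℕ→ℚ : ℕ → ℚ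
ℕ→ℚ n = (+ n) ℚ./ 1

-- The pattern P ⊆ ℤ^r, a finite nonempty set given as a nonempty list
-- (with head y₀).  For A ⊆ [N]^r, the set
--   {x ∈ ℤ^r : x + d y ∈ A for all y ∈ P}
-- is contained in [N]^r - d y₀, so we count it over that finite range.
countPattern : ∀ {r} → ℕ → List⁺ (Pt r) → (Pt r → Bool) → ℤ → ℕ
countPattern {r} N P A d =
  length (filterᵇ (λ x → and (List.map (λ y → A (x ⊕ (d ⊙ y))) (toList P)))
                  (List.map (λ z → z ⊖ (d ⊙ L⁺.head P)) (box N r)))

-- "β is an admissible value for pdd_P(α)": for every ε > 0 there is N₀ such
-- that for all N ≥ N₀ and all A ⊆ [N]^r with |A| ≥ α N^r there is a nonzero
-- integer d with |{x : x + dP ⊆ A}| ≥ (β - ε) N^r.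
-- pdd_P(α) is the largest such β (the set of such β is closed downward and
-- closed under suprema).
PddAtLeast : ∀ {r} → List⁺ (Pt r) → ℚ → ℚ → Set
PddAtLeast {r} P α β =
  ∀ (ε : ℚ) → 0ℚ < ε →
  Σ ℕ λ N₀ → ∀ (N : ℕ) → N₀ ℕ.≤ N →
  ∀ (A : Pt r → Bool) → SubsetOfBox N A →
  α ℚ.* ℕ→ℚ (N ℕ.^ r) ≤ ℕ→ℚ (card N A) →
  Σ ℤ λ d → d ≢ + 0 × ((β - ε) ℚ.* ℕ→ℚ (N ℕ.^ r) ≤ ℕ→ℚ (countPattern N P A d))

-- pdd_Q(α') ≤ pdd_P(α), expressed via rational thresholds β:
-- every rational β ≤ pdd_Q(α') satisfies β ≤ pdd_P(α).
PddLe : ∀ {r} → List⁺ (Pt r) → ℚ → List⁺ (Pt r) → ℚ → Set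
PddLe {r} Q α' P α = ∀ (β : ℚ) → PddAtLeast Q α' β → PddAtLeast P α β

Mat : ℕ → Set
Mat r = Vec (Vec ℚ r) r

dot : ∀ {r} → Vec ℚ r → Vec ℚ r → ℚ
dot u v = foldr _ ℚ._+_ 0ℚ (zipWith ℚ._*_ u v)

_·v_ : ∀ {r} → Mat r → Vec ℚ r → Vec ℚ r
M ·v v = Vec.map (λ row → dot row v) M

_·m_ : ∀ {r} → Mat r → Mat r → Mat r
M ·m N = Vec.map (λ row → Vec.map (λ col → dot row col) (Vec.transpose N)) M

identityMat : ∀ r → Mat r
identityMat r = Vec.tabulate (λ i → Vec.tabulate (λ j → δ i j))
  where
  open import Data.Fin using (_≟_)
  open import Relation.Nullary using (yes; no)
  δ : Fin r → Fin r → ℚ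
  δ i j with i ≟ j
  ... | yes _ = 1ℚ
  ... | no _ = 0ℚ

InvertibleMat : ∀ {r} → Mat r → Set
InvertibleMat {r} M = Σ (Mat r) λ M' → (M ·m M' ≡ identityMat r) × (M' ·m M ≡ identityMat r)

toℚv : ∀ {r} → Pt r → Vec ℚ r
toℚv = Vec.map (λ z → z ℚ./ 1)

affine : ∀ {r} → Mat r → Vec ℚ r → Vec ℚ r → Vec ℚ r
affine M b x = zipWith ℚ._+_ (M ·v x) b

ImageEq : ∀ {r} → Mat r → Vec ℚ r → List⁺ (Pt r) → List⁺ (Pt r) → Set
ImageEq M b P Q =
  (∀ y → y ∈ toList P → ∃ λ q → q ∈ toList Q × affine M b (toℚv y) ≡ toℚv q) ×
  (∀ q → q ∈ toList Q → ∃ λ y → y ∈ toList P × affine M b (toℚv y) ≡ toℚv q)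

module Submission where

-- Write φ(y) = M y + b and let k be a common denominator of the entries of M, so that L = k M is an
-- injective integer matrix and a ↦ L a + t embeds [N]^r into [K N]^r for a constant K. Colour the
-- points a of A ⊆ [N]^r by the residue, modulo k·|g|, of a coordinate of L a + t in which two points
-- of Q differ by g ≠ 0. The image Ã of the largest of the m colour classes has density at least
-- α / (K^r m) in [K N]^r. If z + d′Q ⊆ Ã, the common residue forces k ∣ d′, and writing
-- z + d′ φ(y) = L a_y + t, the point x = a_y − (d′/k) y does not depend on y ∈ P. So x + (d′/k) P ⊆ A,
-- and z ↦ x is injective: A has at least as many P-patterns of scale d′/k as Ã has Q-patterns of
-- scale d′, whence pdd_P(α) ≥ pdd_Q(α / (K^r m + 1)). When Q, hence P, is a single point, one colour
-- suffices and every scale works.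

open import Defs

open import Data.Bool.Base using (Bool; true; false; _∧_; if_then_else_; T)
open import Data.Bool.ListAction using (all; any)
open import Data.Bool.Properties using (T-∧; T-≡)
open import Data.Fin.Base as Fin using (Fin)
import Data.Fin.Properties as Fin
open import Data.Integer.Base as ℤ using (ℤ; +_; -[1+_])
import Data.Integer.DivMod as ℤ
import Data.Integer.Properties as ℤ
import Data.Integer.Tactic.RingSolver as ℤ-Solver
open import Data.List.Base as List using (List; []; _∷_; upTo; concatMap; cartesianProductWith; length; filterᵇ; _++_)
open import Data.List.Membership.Propositional using (_∈_; _─_; find; lose)
import Data.List.Membership.Propositional.Properties as ∈
open import Data.List.NonEmpty.Base as List⁺ using (List⁺; toList)
import Data.List.Properties as List
open import Data.List.Relation.Binary.Subset.Propositional using (_⊆_)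
import Data.List.Relation.Unary.All as All
import Data.List.Relation.Unary.All.Properties as All
import Data.List.Relation.Unary.AllPairs as AllPairs
open import Data.List.Relation.Unary.Any using (here; there; index)
import Data.List.Relation.Unary.Any.Properties as Any
open import Data.List.Relation.Unary.Unique.Propositional using (Unique)
import Data.List.Relation.Unary.Unique.Propositional.Properties as Unique
open import Data.Nat.Base as ℕ using (ℕ; zero; suc)
import Data.Nat.Coprimality as Coprime
open import Data.Nat.Divisibility as ℕ using (_∣_; divides; ∣-trans; m∣m*n; n∣m*n; module ∣-Reasoning)
open import Data.Nat.DivMod using (m/n*n≡m)
import Data.Nat.Properties as ℕ
import Data.Nat.Tactic.RingSolver as ℕ-Solver
open import Data.Product.Base using (Σ; ∃; _×_; _,_; proj₁; proj₂)
open import Data.Rational.Base as ℚ using (ℚ; mkℚ; 0ℚ; 1ℚ; ↥_; ↧ₙ_; _+_; _*_; _-_; -_; _≤_; _<_)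
import Data.Rational.Properties as ℚ
open import Data.Rational.Unnormalised.Base using (mkℚᵘ; *≡*)
open import Data.Sum.Base using (_⊎_; inj₁; inj₂)
open import Data.Vec.Base as Vec using (Vec; []; _∷_; lookup; map; transpose; replicate; _⊛_)
import Data.Vec.Properties as Vec
open import Data.Vec.Relation.Binary.Pointwise.Extensional using (ext; Pointwise-≡⇒≡)
open import Function.Base using (_∘_)
open import Function.Bundles using (Equivalence)
open import Level using (0ℓ)
open import Relation.Binary.PropositionalEquality
open import Relation.Nullary using (Dec; yes; no; does; contradiction)
open import Relation.Nullary.Decidable using (dec⇒maybe; dec-true; dec-false; isYes; toWitness; fromWitness)
open import Tactic.RingSolver using (solve-∀)
import Tactic.RingSolver.Core.AlmostCommutativeRing as ACR

ℚ-ring : ACR.AlmostCommutativeRing 0ℓ 0ℓ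
ℚ-ring = ACR.fromCommutativeRing ℚ.+-*-commutativeRing (λ x → dec⇒maybe (0ℚ ℚ.≟ x))

ι : ℤ → ℚ
ι z = z ℚ./ 1

ι≡mkℚ : ∀ z → ι z ≡ mkℚ z 0 (Coprime.sym (Coprime.1-coprimeTo ℤ.∣ z ∣))
ι≡mkℚ z = ℚ.↥p/↧p≡p (mkℚ z 0 (Coprime.sym (Coprime.1-coprimeTo ℤ.∣ z ∣)))

ι-homo-+ : ∀ a b → ι (a ℤ.+ b) ≡ ι a + ι b
ι-homo-+ a b = sym (trans (cong₂ _+_ (ι≡mkℚ a) (ι≡mkℚ b))
  (cong (ℚ._/ 1) (cong₂ ℤ._+_ (ℤ.*-identityʳ a) (ℤ.*-identityʳ b))))

ι-homo-* : ∀ a b → ι (a ℤ.* b) ≡ ι a * ι b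
ι-homo-* a b = sym (cong₂ _*_ (ι≡mkℚ a) (ι≡mkℚ b))

ι-homo-neg : ∀ a → ι (ℤ.- a) ≡ - ι a
ι-homo-neg a = trans (ι≡mkℚ (ℤ.- a)) (trans (neg-mkℚ a) (cong -_ (sym (ι≡mkℚ a))))
  where
  neg-mkℚ : ∀ a → mkℚ (ℤ.- a) 0 (Coprime.sym (Coprime.1-coprimeTo ℤ.∣ ℤ.- a ∣))
                 ≡ - mkℚ a 0 (Coprime.sym (Coprime.1-coprimeTo ℤ.∣ a ∣))
  neg-mkℚ (+ zero)  = refl
  neg-mkℚ (+ suc n) = refl
  neg-mkℚ -[1+ n ]  = refl

ι-homo-- : ∀ a b → ι (a ℤ.- b) ≡ ι a - ι b
ι-homo-- a b = trans (ι-homo-+ a (ℤ.- b)) (cong (_+_ (ι a)) (ι-homo-neg b))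

ι-injective : ∀ {a b} → ι a ≡ ι b → a ≡ b
ι-injective {a} {b} eq = begin
  a          ≡⟨ cong ↥_ (ι≡mkℚ a) ⟨
  ↥ ι a      ≡⟨ cong ↥_ eq ⟩
  ↥ ι b      ≡⟨ cong ↥_ (ι≡mkℚ b) ⟩
  b          ∎
  where open ≡-Reasoning

ι-mono-≤ : ∀ {a b} → a ℤ.≤ b → ι a ≤ ι b
ι-mono-≤ {a} {b} a≤b rewrite ι≡mkℚ a | ι≡mkℚ b =
  ℚ.*≤* (subst₂ ℤ._≤_ (sym (ℤ.*-identityʳ a)) (sym (ℤ.*-identityʳ b)) a≤b)

ℕ→ℚ-homo-* : ∀ m n → ℕ→ℚ (m ℕ.* n) ≡ ℕ→ℚ m * ℕ→ℚ n
ℕ→ℚ-homo-* m n = trans (cong ι (ℤ.pos-* m n)) (ι-homo-* (+ m) (+ n))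

ℕ→ℚ-mono-≤ : ∀ {m n} → m ℕ.≤ n → ℕ→ℚ m ≤ ℕ→ℚ n
ℕ→ℚ-mono-≤ m≤n = ι-mono-≤ (ℤ.+≤+ m≤n)

ℕ→ℚ-nonNeg : ∀ n → 0ℚ ≤ ℕ→ℚ n
ℕ→ℚ-nonNeg n = ℕ→ℚ-mono-≤ {0} {n} ℕ.z≤n

ℕ→ℚ-pos : ∀ n .{{_ : ℕ.NonZero n}} → 0ℚ < ℕ→ℚ n
ℕ→ℚ-pos (suc n) rewrite ι≡mkℚ (+ suc n) = ℚ.*<* (ℤ.+<+ (ℕ.s≤s ℕ.z≤n))

*-cancelˡ-≡ : ∀ p .{{_ : ℚ.NonZero p}} {x y} → p * x ≡ p * y → x ≡ y
*-cancelˡ-≡ p {x} {y} px≡py = begin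
  x                 ≡⟨ ℚ.*-identityˡ x ⟨
  1ℚ * x            ≡⟨ cong (_* x) (ℚ.*-inverseˡ p) ⟨
  ℚ.1/ p * p * x    ≡⟨ ℚ.*-assoc (ℚ.1/ p) p x ⟩
  ℚ.1/ p * (p * x)  ≡⟨ cong (ℚ.1/ p *_) px≡py ⟩
  ℚ.1/ p * (p * y)  ≡⟨ ℚ.*-assoc (ℚ.1/ p) p y ⟨
  ℚ.1/ p * p * y    ≡⟨ cong (_* y) (ℚ.*-inverseˡ p) ⟩
  1ℚ * y            ≡⟨ ℚ.*-identityˡ y ⟩
  y                 ∎
  where open ≡-Reasoning

ℕ→ℚ-*-cancelˡ-≡ : ∀ n .{{_ : ℕ.NonZero n}} {x y} → ℕ→ℚ n * x ≡ ℕ→ℚ n * y → x ≡ y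
ℕ→ℚ-*-cancelˡ-≡ n = *-cancelˡ-≡ (ℕ→ℚ n) {{ℚ.>-nonZero (ℕ→ℚ-pos n)}}

ι↥≡↧* : ∀ q → ι (↥ q) ≡ ℕ→ℚ (↧ₙ q) * q
ι↥≡↧* q@(mkℚ n d-1 _) = begin
  n ℚ./ 1                                ≡⟨ ℚ.fromℚᵘ-cong {mkℚᵘ n 0} {mkℚᵘ (+ suc d-1 ℤ.* n) (d-1 ℕ.+ 0)}
                                                           (*≡* cross) ⟩
  (+ suc d-1 ℤ.* n) ℚ./ suc (d-1 ℕ.+ 0)  ≡⟨ cong (ℚ._* q) (ι≡mkℚ (+ suc d-1)) ⟨
  ℕ→ℚ (suc d-1) * q                      ∎
  where
  open ≡-Reasoning
  cross : n ℤ.* + suc (d-1 ℕ.+ 0) ≡ (+ suc d-1 ℤ.* n) ℤ.* + 1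
  cross rewrite ℕ.+-identityʳ d-1 = trans (ℤ.*-comm n (+ suc d-1)) (sym (ℤ.*-identityʳ _))

1/suc : ℕ → ℚ
1/suc n = mkℚ (+ 1) n (Coprime.1-coprimeTo (suc n))

1/suc-pos : ∀ n → 0ℚ < 1/suc n
1/suc-pos n = ℚ.*<* (ℤ.+<+ (ℕ.s≤s ℕ.z≤n))

1/suc<1 : ∀ n .{{_ : ℕ.NonZero n}} → 1/suc n < 1ℚ
1/suc<1 (suc n) = ℚ.*<* (ℤ.+<+ (ℕ.s≤s (ℕ.s≤s ℕ.z≤n)))

1/suc*suc≡1 : ∀ n → 1/suc n * ℕ→ℚ (suc n) ≡ 1ℚ
1/suc*suc≡1 n rewrite ι≡mkℚ (+ suc n) =
  ℚ.fromℚᵘ-cong {mkℚᵘ (+ 1 ℤ.* + suc n) (n ℕ.* 1)} {mkℚᵘ (+ 1) 0} (*≡* cross)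
  where
  cross : (+ 1 ℤ.* + suc n) ℤ.* + 1 ≡ + 1 ℤ.* + suc (n ℕ.* 1)
  cross = trans (ℤ.*-identityʳ _) (cong (λ m → + 1 ℤ.* + suc m) (sym (ℕ.*-identityʳ n)))

1/suc*≤1 : ∀ n → 1/suc n * ℕ→ℚ n ≤ 1ℚ
1/suc*≤1 n = begin
  1/suc n * ℕ→ℚ n        ≤⟨ ℚ.*-monoˡ-≤-nonNeg (1/suc n) {{ℚ.nonNegative (ℚ.<⇒≤ (1/suc-pos n))}}
                                               (ℕ→ℚ-mono-≤ (ℕ.n≤1+n n)) ⟩
  1/suc n * ℕ→ℚ (suc n)  ≡⟨ 1/suc*suc≡1 n ⟩
  1ℚ                     ∎
  where open ℚ.≤-Reasoning

density-transfer : ∀ c α s n m a b → 0ℚ ≤ c → c * ℕ→ℚ (s ℕ.* m) ≤ 1ℚ →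
  α * ℕ→ℚ n ≤ ℕ→ℚ a → a ℕ.≤ m ℕ.* b → c * α * ℕ→ℚ (s ℕ.* n) ≤ ℕ→ℚ b
density-transfer c α s n m a b 0≤c c*sm≤1 α-dense a≤mb = begin
  c * α * ℕ→ℚ (s ℕ.* n)          ≡⟨ cong (c * α *_) (ℕ→ℚ-homo-* s n) ⟩
  c * α * (ℕ→ℚ s * ℕ→ℚ n)        ≡⟨ regroup c α (ℕ→ℚ s) (ℕ→ℚ n) ⟩
  c * ℕ→ℚ s * (α * ℕ→ℚ n)        ≤⟨ ℚ.*-monoˡ-≤-nonNeg (c * ℕ→ℚ s) α-dense ⟩
  c * ℕ→ℚ s * ℕ→ℚ a              ≤⟨ ℚ.*-monoˡ-≤-nonNeg (c * ℕ→ℚ s) (ℕ→ℚ-mono-≤ a≤mb) ⟩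
  c * ℕ→ℚ s * ℕ→ℚ (m ℕ.* b)      ≡⟨ cong (c * ℕ→ℚ s *_) (ℕ→ℚ-homo-* m b) ⟩
  c * ℕ→ℚ s * (ℕ→ℚ m * ℕ→ℚ b)    ≡⟨ reassoc c (ℕ→ℚ s) (ℕ→ℚ m) (ℕ→ℚ b) ⟩
  c * (ℕ→ℚ s * ℕ→ℚ m) * ℕ→ℚ b    ≡⟨ cong (λ x → c * x * ℕ→ℚ b) (ℕ→ℚ-homo-* s m) ⟨
  c * ℕ→ℚ (s ℕ.* m) * ℕ→ℚ b      ≤⟨ ℚ.*-monoʳ-≤-nonNeg (ℕ→ℚ b) c*sm≤1 ⟩
  1ℚ * ℕ→ℚ b                     ≡⟨ ℚ.*-identityˡ (ℕ→ℚ b) ⟩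
  ℕ→ℚ b                          ∎
  where
  open ℚ.≤-Reasoning
  instance
    _ = ℚ.nonNegative 0≤c
    _ = ℚ.nonNegative (ℕ→ℚ-nonNeg s)
    _ = ℚ.nonNegative (ℕ→ℚ-nonNeg b)
    _ = ℚ.nonNeg*nonNeg⇒nonNeg c (ℕ→ℚ s)
  regroup : ∀ c α S N → c * α * (S * N) ≡ c * S * (α * N)
  regroup = solve-∀ ℚ-ring
  reassoc : ∀ c S m B → c * S * (m * B) ≡ c * (S * m) * B
  reassoc = solve-∀ ℚ-ring

lower-bound-transfer : ∀ x n n′ a b → x * ℕ→ℚ n′ ≤ ℕ→ℚ a → a ℕ.≤ b → n ℕ.≤ n′ → x * ℕ→ℚ n ≤ ℕ→ℚ b
lower-bound-transfer x n n′ a b x*n′≤a a≤b n≤n′ with ℚ.≤-total x 0ℚ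
... | inj₁ x≤0 = begin
  x * ℕ→ℚ n    ≤⟨ ℚ.*-monoʳ-≤-nonNeg (ℕ→ℚ n) {{ℚ.nonNegative (ℕ→ℚ-nonNeg n)}} x≤0 ⟩
  0ℚ * ℕ→ℚ n   ≡⟨ ℚ.*-zeroˡ (ℕ→ℚ n) ⟩
  0ℚ           ≤⟨ ℕ→ℚ-nonNeg b ⟩
  ℕ→ℚ b        ∎
  where open ℚ.≤-Reasoning
... | inj₂ 0≤x = begin
  x * ℕ→ℚ n    ≤⟨ ℚ.*-monoˡ-≤-nonNeg x {{ℚ.nonNegative 0≤x}} (ℕ→ℚ-mono-≤ n≤n′) ⟩
  x * ℕ→ℚ n′   ≤⟨ x*n′≤a ⟩
  ℕ→ℚ a        ≤⟨ ℕ→ℚ-mono-≤ a≤b ⟩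
  ℕ→ℚ b        ∎
  where open ℚ.≤-Reasoning

sign◃-quotient : ∀ d q k → ℤ.∣ d ∣ ≡ q ℕ.* k → d ≡ (ℤ.sign d ℤ.◃ q) ℤ.* + k
sign◃-quotient (+ n)    zero    k ∣d∣≡qk = cong +_ ∣d∣≡qk
sign◃-quotient (+ n)    (suc q) k ∣d∣≡qk = trans (cong +_ ∣d∣≡qk) (ℤ.pos-* (suc q) k)
sign◃-quotient -[1+ n ] (suc q) k ∣d∣≡qk =
  trans (cong ℤ.-_ (trans (cong +_ ∣d∣≡qk) (ℤ.pos-* (suc q) k))) (ℤ.neg-distribˡ-* (+ suc q) (+ k))

%ℕ-≡⇒∣∣-∣ : ∀ a b m .{{_ : ℕ.NonZero m}} → a ℤ.%ℕ m ≡ b ℤ.%ℕ m → m ∣ ℤ.∣ a ℤ.- b ∣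
%ℕ-≡⇒∣∣-∣ a b m a%m≡b%m =
  divides ℤ.∣ a ℤ./ℕ m ℤ.- b ℤ./ℕ m ∣ (trans (cong ℤ.∣_∣ a-b≡) (ℤ.abs-* (a ℤ./ℕ m ℤ.- b ℤ./ℕ m) (+ m)))
  where
  open ≡-Reasoning
  cancel : ∀ r x y m → (r ℤ.+ x ℤ.* m) ℤ.- (r ℤ.+ y ℤ.* m) ≡ (x ℤ.- y) ℤ.* m
  cancel = ℤ-Solver.solve-∀
  a-b≡ : a ℤ.- b ≡ (a ℤ./ℕ m ℤ.- b ℤ./ℕ m) ℤ.* + m
  a-b≡ = begin
    a ℤ.- b
      ≡⟨ cong₂ ℤ._-_ (ℤ.a≡a%ℕn+[a/ℕn]*n a m) (ℤ.a≡a%ℕn+[a/ℕn]*n b m) ⟩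
    (+ (a ℤ.%ℕ m) ℤ.+ a ℤ./ℕ m ℤ.* + m) ℤ.- (+ (b ℤ.%ℕ m) ℤ.+ b ℤ./ℕ m ℤ.* + m)
      ≡⟨ cong (λ ρ → (+ (a ℤ.%ℕ m) ℤ.+ a ℤ./ℕ m ℤ.* + m) ℤ.- (+ ρ ℤ.+ b ℤ./ℕ m ℤ.* + m)) a%m≡b%m ⟨
    (+ (a ℤ.%ℕ m) ℤ.+ a ℤ./ℕ m ℤ.* + m) ℤ.- (+ (a ℤ.%ℕ m) ℤ.+ b ℤ./ℕ m ℤ.* + m)
      ≡⟨ cancel (+ (a ℤ.%ℕ m)) (a ℤ./ℕ m) (b ℤ./ℕ m) (+ m) ⟩
    (a ℤ./ℕ m ℤ.- b ℤ./ℕ m) ℤ.* + m ∎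

^-distrib-* : ∀ m n p → (m ℕ.* n) ℕ.^ p ≡ m ℕ.^ p ℕ.* n ℕ.^ p
^-distrib-* m n zero    = refl
^-distrib-* m n (suc p) rewrite ^-distrib-* m n p = interchange m n (m ℕ.^ p) (n ℕ.^ p)
  where
  interchange : ∀ a b c d → a ℕ.* b ℕ.* (c ℕ.* d) ≡ a ℕ.* c ℕ.* (b ℕ.* d)
  interchange = ℕ-Solver.solve-∀

vecExt : ∀ {A : Set} {n} {u v : Vec A n} → (∀ i → lookup u i ≡ lookup v i) → u ≡ v
vecExt eq = Pointwise-≡⇒≡ (ext eq)

dot-zeroRow : ∀ {n} (row v : Vec ℚ n) → (∀ j → lookup row j ≡ 0ℚ) → dot row v ≡ 0ℚ
dot-zeroRow []        []      _    = refl
dot-zeroRow (x ∷ row) (a ∷ v) is0 rewrite is0 Fin.zero | dot-zeroRow row v (is0 ∘ Fin.suc) =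
  trans (ℚ.+-identityʳ (0ℚ * a)) (ℚ.*-zeroˡ a)

dot-unitRow : ∀ {n} (row v : Vec ℚ n) i → lookup row i ≡ 1ℚ → (∀ j → i ≢ j → lookup row j ≡ 0ℚ) →
  dot row v ≡ lookup v i
dot-unitRow (x ∷ row) (a ∷ v) Fin.zero is1 is0
  rewrite is1 | dot-zeroRow row v (λ j → is0 (Fin.suc j) λ ()) =
  trans (ℚ.+-identityʳ (1ℚ * a)) (ℚ.*-identityˡ a)
dot-unitRow (x ∷ row) (a ∷ v) (Fin.suc i) is1 is0
  rewrite is0 Fin.zero (λ ()) | dot-unitRow row v i is1 (λ j i≢j → is0 (Fin.suc j) (i≢j ∘ Fin.suc-injective)) =
  trans (cong (_+ lookup v i) (ℚ.*-zeroˡ a)) (ℚ.+-identityˡ (lookup v i))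

identityMat-·v : ∀ {r} (v : Vec ℚ r) → identityMat r ·v v ≡ v
identityMat-·v {r} v = vecExt λ i → trans (Vec.lookup-map i (λ row → dot row v) (identityMat r))
  (dot-unitRow (lookup (identityMat r) i) v i (diagonal i) (offDiagonal i))
  where
  entry : ∀ i j → lookup (lookup (identityMat r) i) j ≡ _
  entry i j = trans (cong (λ row → lookup row j) (Vec.lookup∘tabulate _ i)) (Vec.lookup∘tabulate _ j)
  diagonal : ∀ i → lookup (lookup (identityMat r) i) i ≡ 1ℚ
  diagonal i rewrite entry i i with i Fin.≟ i
  ... | yes _  = refl
  ... | no i≢i = contradiction refl i≢i
  offDiagonal : ∀ i j → i ≢ j → lookup (lookup (identityMat r) i) j ≡ 0ℚ
  offDiagonal i j i≢j rewrite entry i j with i Fin.≟ j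
  ... | yes i≡j = contradiction i≡j i≢j
  ... | no _    = refl

dot-transpose-[] : ∀ {m} (v : Vec ℚ m) → dot (map (dot []) (transpose {n = m} [])) v ≡ 0ℚ
dot-transpose-[] {m} v = dot-zeroRow (map (dot []) (replicate m [])) v λ j →
  trans (Vec.lookup-map j (dot []) (replicate m [])) (cong (dot []) (Vec.lookup-replicate j []))

dot-transpose-∷ : ∀ {m n} x (w : Vec ℚ n) (row : Vec ℚ m) (T : Vec (Vec ℚ n) m) v →
  dot (map (dot (x ∷ w)) ((replicate m _∷_ ⊛ row) ⊛ T)) v ≡ x * dot row v + dot (map (dot w) T) v
dot-transpose-∷ x w []        []      []      = sym (trans (ℚ.+-identityʳ (x * 0ℚ)) (ℚ.*-zeroʳ x))
dot-transpose-∷ x w (a ∷ row) (c ∷ T) (b ∷ v) rewrite dot-transpose-∷ x w row T v =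
  shuffle x a b (dot w c) (dot row v) (dot (map (dot w) T) v)
  where
  shuffle : ∀ x a b c R S → (x * a + c) * b + (x * R + S) ≡ x * (a * b + R) + (c * b + S)
  shuffle = solve-∀ ℚ-ring

dot-map-dot : ∀ {m n} (w : Vec ℚ n) (M : Vec (Vec ℚ m) n) v →
  dot w (map (λ row → dot row v) M) ≡ dot (map (dot w) (transpose M)) v
dot-map-dot []      []      v = sym (dot-transpose-[] v)
dot-map-dot (x ∷ w) (row ∷ M) v rewrite dot-map-dot w M v = sym (dot-transpose-∷ x w row (transpose M) v)

·v-·m : ∀ {r} (M′ M : Mat r) u → M′ ·v (M ·v u) ≡ (M′ ·m M) ·v u
·v-·m M′ M u = trans (Vec.map-cong (λ w → dot-map-dot w M u) M′) (Vec.map-∘ _ _ M′)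

·v-injective : ∀ {r} {M M′ : Mat r} → M′ ·m M ≡ identityMat r → ∀ {u v} → M ·v u ≡ M ·v v → u ≡ v
·v-injective {r} {M} {M′} M′M≡I {u} {v} Mu≡Mv = begin
  u                    ≡⟨ identityMat-·v u ⟨
  identityMat r ·v u   ≡⟨ cong (_·v u) M′M≡I ⟨
  (M′ ·m M) ·v u       ≡⟨ ·v-·m M′ M u ⟨
  M′ ·v (M ·v u)       ≡⟨ cong (M′ ·v_) Mu≡Mv ⟩
  M′ ·v (M ·v v)       ≡⟨ ·v-·m M′ M v ⟩
  (M′ ·m M) ·v v       ≡⟨ cong (_·v v) M′M≡I ⟩
  identityMat r ·v v   ≡⟨ identityMat-·v v ⟩
  v                    ∎
  where open ≡-Reasoning

dot-scaleˡ : ∀ {n} c (w v : Vec ℚ n) → dot (map (c *_) w) v ≡ c * dot w v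
dot-scaleˡ c []      []      = sym (ℚ.*-zeroʳ c)
dot-scaleˡ c (x ∷ w) (a ∷ v) rewrite dot-scaleˡ c w v = distrib c x a (dot w v)
  where
  distrib : ∀ c x a D → c * x * a + c * D ≡ c * (x * a + D)
  distrib = solve-∀ ℚ-ring

denominator : ∀ {n} → Vec ℚ n → ℕ
denominator = Vec.foldr _ (λ q k → ↧ₙ q ℕ.* k) 1

matDenominator : ∀ {m n} → Vec (Vec ℚ n) m → ℕ
matDenominator = Vec.foldr _ (λ row k → denominator row ℕ.* k) 1

↧-∣-denominator : ∀ {n} (v : Vec ℚ n) i → ↧ₙ lookup v i ∣ denominator v
↧-∣-denominator (q ∷ v) Fin.zero    = m∣m*n (denominator v)
↧-∣-denominator (q ∷ v) (Fin.suc i) = ∣-trans (↧-∣-denominator v i) (n∣m*n (↧ₙ q))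

denominator-∣-matDenominator : ∀ {m n} (M : Vec (Vec ℚ n) m) i → denominator (lookup M i) ∣ matDenominator M
denominator-∣-matDenominator (row ∷ M) Fin.zero    = m∣m*n (matDenominator M)
denominator-∣-matDenominator (row ∷ M) (Fin.suc i) =
  ∣-trans (denominator-∣-matDenominator M i) (n∣m*n (denominator row))

denominator-nonZero : ∀ {n} (v : Vec ℚ n) → ℕ.NonZero (denominator v)
denominator-nonZero []      = _
denominator-nonZero (q ∷ v) = ℕ.m*n≢0 (↧ₙ q) (denominator v) {{_}} {{denominator-nonZero v}}

matDenominator-nonZero : ∀ {m n} (M : Vec (Vec ℚ n) m) → ℕ.NonZero (matDenominator M)
matDenominator-nonZero []        = _
matDenominator-nonZero (row ∷ M) =
  ℕ.m*n≢0 (denominator row) (matDenominator M) {{denominator-nonZero row}} {{matDenominator-nonZero M}}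

clear : ℕ → ℚ → ℤ
clear k q = ↥ q ℤ.* + (k ℕ./ ↧ₙ q)

ι-clear : ∀ k q → ↧ₙ q ∣ k → ι (clear k q) ≡ ℕ→ℚ k * q
ι-clear k q ↧q∣k = begin
  ι (↥ q ℤ.* + (k ℕ./ ↧ₙ q))             ≡⟨ ι-homo-* (↥ q) (+ (k ℕ./ ↧ₙ q)) ⟩
  ι (↥ q) * ℕ→ℚ (k ℕ./ ↧ₙ q)             ≡⟨ cong (_* ℕ→ℚ (k ℕ./ ↧ₙ q)) (ι↥≡↧* q) ⟩
  ℕ→ℚ (↧ₙ q) * q * ℕ→ℚ (k ℕ./ ↧ₙ q)     ≡⟨ rearrange (ℕ→ℚ (↧ₙ q)) q (ℕ→ℚ (k ℕ./ ↧ₙ q)) ⟩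
  ℕ→ℚ (k ℕ./ ↧ₙ q) * ℕ→ℚ (↧ₙ q) * q     ≡⟨ cong (_* q) (ℕ→ℚ-homo-* (k ℕ./ ↧ₙ q) (↧ₙ q)) ⟨
  ℕ→ℚ (k ℕ./ ↧ₙ q ℕ.* ↧ₙ q) * q          ≡⟨ cong (λ n → ℕ→ℚ n * q) (m/n*n≡m ↧q∣k) ⟩
  ℕ→ℚ k * q                              ∎
  where
  open ≡-Reasoning
  rearrange : ∀ a b c → a * b * c ≡ c * a * b
  rearrange = solve-∀ ℚ-ring

⊖-⊕ : ∀ {r} (u w : Pt r) → (u ⊖ w) ⊕ w ≡ u
⊖-⊕ []      []      = refl
⊖-⊕ (a ∷ u) (c ∷ w) = cong₂ _∷_ (sub-add a c) (⊖-⊕ u w)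
  where
  sub-add : ∀ a c → a ℤ.- c ℤ.+ c ≡ a
  sub-add = ℤ-Solver.solve-∀

⊕-⊖ : ∀ {r} (u w : Pt r) → (u ⊕ w) ⊖ w ≡ u
⊕-⊖ []      []      = refl
⊕-⊖ (a ∷ u) (c ∷ w) = cong₂ _∷_ (add-sub a c) (⊕-⊖ u w)
  where
  add-sub : ∀ a c → a ℤ.+ c ℤ.- c ≡ a
  add-sub = ℤ-Solver.solve-∀

⊕-cancelʳ : ∀ {r} (w : Pt r) {u v : Pt r} → u ⊕ w ≡ v ⊕ w → u ≡ v
⊕-cancelʳ w {u} {v} eq = trans (sym (⊕-⊖ u w)) (trans (cong (_⊖ w) eq) (⊕-⊖ v w))

⊖-cancelʳ : ∀ {r} (w : Pt r) {u v : Pt r} → u ⊖ w ≡ v ⊖ w → u ≡ v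
⊖-cancelʳ w {u} {v} eq = trans (sym (⊖-⊕ u w)) (trans (cong (_⊕ w) eq) (⊖-⊕ v w))

toℚv-injective : ∀ {r} {u v : Pt r} → toℚv u ≡ toℚv v → u ≡ v
toℚv-injective {u = []}    {[]}    _  = refl
toℚv-injective {u = a ∷ u} {b ∷ v} eq =
  cong₂ _∷_ (ι-injective (cong Vec.head eq)) (toℚv-injective (cong Vec.tail eq))

_≟ₚ_ : ∀ {r} (u v : Pt r) → Dec (u ≡ v)
_≟ₚ_ = Vec.≡-dec ℤ._≟_

vec-≢⇒lookup-≢ : ∀ {n} {u v : Pt n} → u ≢ v → ∃ λ i → lookup u i ≢ lookup v i
vec-≢⇒lookup-≢ {n} {u} {v} u≢v = Fin.¬∀⟶∃¬ n _ (λ i → lookup u i ℤ.≟ lookup v i) (u≢v ∘ vecExt)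

lookup-⊕-⊙ : ∀ {r} (z : Pt r) d q i → lookup (z ⊕ (d ⊙ q)) i ≡ lookup z i ℤ.+ d ℤ.* lookup q i
lookup-⊕-⊙ z d q i =
  trans (Vec.lookup-zipWith ℤ._+_ i z (d ⊙ q)) (cong (ℤ._+_ (lookup z i)) (Vec.lookup-map i (d ℤ.*_) q))

dotℤ : ∀ {n} → Vec ℤ n → Vec ℤ n → ℤ
dotℤ u v = Vec.foldr _ ℤ._+_ (+ 0) (Vec.zipWith ℤ._*_ u v)

_·ℤ_ : ∀ {m n} → Vec (Vec ℤ n) m → Pt n → Pt m
L ·ℤ a = map (λ row → dotℤ row a) L

ι-dotℤ : ∀ {n} (u v : Vec ℤ n) → ι (dotℤ u v) ≡ dot (toℚv u) (toℚv v)
ι-dotℤ []      []      = refl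
ι-dotℤ (a ∷ u) (b ∷ v) = trans (ι-homo-+ (a ℤ.* b) (dotℤ u v)) (cong₂ _+_ (ι-homo-* a b) (ι-dotℤ u v))

dot-toℚv-⊖ : ∀ {n} (w : Vec ℚ n) (a y : Pt n) d →
  dot w (toℚv (a ⊖ (d ⊙ y))) ≡ dot w (toℚv a) - ι d * dot w (toℚv y)
dot-toℚv-⊖ []      []      []      d = 0≡0-D*0 (ι d)
  where
  0≡0-D*0 : ∀ D → 0ℚ ≡ 0ℚ - D * 0ℚ
  0≡0-D*0 = solve-∀ ℚ-ring
dot-toℚv-⊖ (x ∷ w) (a ∷ as) (y ∷ ys) d
  rewrite dot-toℚv-⊖ w as ys d | ι-homo-- a (d ℤ.* y) | ι-homo-* d y =
  distrib x (ι a) (ι d) (ι y) (dot w (toℚv as)) (dot w (toℚv ys))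
  where
  distrib : ∀ x A D Y S T → x * (A - D * Y) + (S - D * T) ≡ x * A + S - D * (x * Y + T)
  distrib = solve-∀ ℚ-ring

norm₁ : ∀ {n} → Vec ℤ n → ℕ
norm₁ = Vec.foldr _ (λ x s → ℤ.∣ x ∣ ℕ.+ s) 0

matNorm₁ : ∀ {m n} → Vec (Vec ℤ n) m → ℕ
matNorm₁ = Vec.foldr _ (λ row s → norm₁ row ℕ.+ s) 0

∣dotℤ∣≤norm₁*bound : ∀ {n} N (u a : Vec ℤ n) → (∀ i → ℤ.∣ lookup a i ∣ ℕ.≤ N) → ℤ.∣ dotℤ u a ∣ ℕ.≤ norm₁ u ℕ.* N
∣dotℤ∣≤norm₁*bound N []      []       _     = ℕ.z≤n
∣dotℤ∣≤norm₁*bound N (x ∷ u) (a ∷ as) bound = begin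
  ℤ.∣ x ℤ.* a ℤ.+ dotℤ u as ∣             ≤⟨ ℤ.∣i+j∣≤∣i∣+∣j∣ (x ℤ.* a) (dotℤ u as) ⟩
  ℤ.∣ x ℤ.* a ∣ ℕ.+ ℤ.∣ dotℤ u as ∣       ≡⟨ cong (ℕ._+ ℤ.∣ dotℤ u as ∣) (ℤ.abs-* x a) ⟩
  ℤ.∣ x ∣ ℕ.* ℤ.∣ a ∣ ℕ.+ ℤ.∣ dotℤ u as ∣ ≤⟨ ℕ.+-mono-≤ (ℕ.*-monoʳ-≤ ℤ.∣ x ∣ (bound Fin.zero))
                                                       (∣dotℤ∣≤norm₁*bound N u as (bound ∘ Fin.suc)) ⟩
  ℤ.∣ x ∣ ℕ.* N ℕ.+ norm₁ u ℕ.* N          ≡⟨ ℕ.*-distribʳ-+ N ℤ.∣ x ∣ (norm₁ u) ⟨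
  (ℤ.∣ x ∣ ℕ.+ norm₁ u) ℕ.* N              ∎
  where open ℕ.≤-Reasoning

norm₁≤matNorm₁ : ∀ {m n} (L : Vec (Vec ℤ n) m) i → norm₁ (lookup L i) ℕ.≤ matNorm₁ L
norm₁≤matNorm₁ (row ∷ L) Fin.zero    = ℕ.m≤m+n (norm₁ row) (matNorm₁ L)
norm₁≤matNorm₁ (row ∷ L) (Fin.suc i) = ℕ.≤-trans (norm₁≤matNorm₁ L i) (ℕ.m≤n+m (matNorm₁ L) (norm₁ row))

∣·ℤ∣≤matNorm₁*bound : ∀ {m n} N (L : Vec (Vec ℤ n) m) (a : Pt n) → (∀ i → ℤ.∣ lookup a i ∣ ℕ.≤ N) →
  ∀ i → ℤ.∣ lookup (L ·ℤ a) i ∣ ℕ.≤ matNorm₁ L ℕ.* N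
∣·ℤ∣≤matNorm₁*bound N L a bound i rewrite Vec.lookup-map i (λ row → dotℤ row a) L =
  ℕ.≤-trans (∣dotℤ∣≤norm₁*bound N (lookup L i) a bound) (ℕ.*-monoˡ-≤ N (norm₁≤matNorm₁ L i))

concatMap-map≡cartesianProductWith : ∀ {A B C : Set} (f : A → B → C) xs ys →
  concatMap (λ x → List.map (f x) ys) xs ≡ cartesianProductWith f xs ys
concatMap-map≡cartesianProductWith f []       ys = refl
concatMap-map≡cartesianProductWith f (x ∷ xs) ys =
  cong (List.map (f x) ys ++_) (concatMap-map≡cartesianProductWith f xs ys)

box-suc : ∀ N r → box N (suc r) ≡ cartesianProductWith (λ k x → + suc k ∷ x) (upTo N) (box N r)
box-suc N r = concatMap-map≡cartesianProductWith (λ k x → + suc k ∷ x) (upTo N) (box N r)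

InRange : ℕ → ℤ → Set
InRange N z = + 1 ℤ.≤ z × z ℤ.≤ + N

∈-box⁻ : ∀ {N r} {x : Pt r} → x ∈ box N r → ∀ i → InRange N (lookup x i)
∈-box⁻ {N} {suc r} x∈ i
  with k , x′ , k<N , x′∈ , refl ← ∈.∈-cartesianProductWith⁻ _ (upTo N) (box N r) (subst (_ ∈_) (box-suc N r) x∈)
  with i
... | Fin.zero   = ℤ.+≤+ (ℕ.s≤s ℕ.z≤n) , ℤ.+≤+ (∈.∈-upTo⁻ k<N)
... | Fin.suc i′ = ∈-box⁻ x′∈ i′

∈-box⁺ : ∀ {N r} (x : Pt r) → (∀ i → InRange N (lookup x i)) → x ∈ box N r
∈-box⁺ {r = zero}  []            _ = here refl
∈-box⁺ {N} {suc r} (+ suc k ∷ x) range with range Fin.zero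
... | _ , ℤ.+≤+ k<N = subst (_ ∈_) (sym (box-suc N r))
  (∈.∈-cartesianProductWith⁺ (λ k x → + suc k ∷ x) (∈.∈-upTo⁺ k<N) (∈-box⁺ x (range ∘ Fin.suc)))
∈-box⁺ (+ zero   ∷ x) range with range Fin.zero
... | ℤ.+≤+ () , _
∈-box⁺ (-[1+ n ] ∷ x) range with range Fin.zero
... | () , _

box-unique : ∀ N r → Unique (box N r)
box-unique N zero    = All.[] AllPairs.∷ AllPairs.[]
box-unique N (suc r) = subst Unique (sym (box-suc N r))
  (Unique.cartesianProductWith⁺ _ cons-injective (Unique.upTo⁺ N) (box-unique N r))
  where
  cons-injective : ∀ {k k′ x x′} → + suc k ∷ x ≡ + suc k′ ∷ x′ → k ≡ k′ × x ≡ x′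
  cons-injective refl = refl , refl

InRange⇒∣∣≤ : ∀ {N z} → InRange N z → ℤ.∣ z ∣ ℕ.≤ N
InRange⇒∣∣≤ (ℤ.+≤+ _ , ℤ.+≤+ z≤N) = z≤N

InRange-mono : ∀ {N N′ z} → N ℕ.≤ N′ → InRange N z → InRange N′ z
InRange-mono N≤N′ (1≤z , z≤N) = 1≤z , ℤ.≤-trans z≤N (ℤ.+≤+ N≤N′)

∣∣≤⇒InRange-shift : ∀ {n z} → ℤ.∣ z ∣ ℕ.≤ n → InRange (n ℕ.+ suc n) (z ℤ.+ + suc n)
∣∣≤⇒InRange-shift {n} {+ m}      m≤n   =
  ℤ.+≤+ (ℕ.≤-trans (ℕ.s≤s ℕ.z≤n) (ℕ.m≤n+m (suc n) m)) , ℤ.+≤+ (ℕ.+-monoˡ-≤ (suc n) m≤n)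
∣∣≤⇒InRange-shift {n} { -[1+ m ]} 1+m≤n rewrite ℤ.[1+m]⊖[1+n]≡m⊖n n m | ℤ.⊖-≥ (ℕ.<⇒≤ 1+m≤n) =
  ℤ.+≤+ (ℕ.m<n⇒0<n∸m 1+m≤n) , ℤ.+≤+ (ℕ.≤-trans (ℕ.m∸n≤m n m) (ℕ.m≤m+n n (suc n)))

-- countPattern N P A d is by definition the length of this list.
patternBases : ∀ {r} → ℕ → List⁺ (Pt r) → (Pt r → Bool) → ℤ → List (Pt r)
patternBases {r} N P A d =
  filterᵇ (λ x → all (λ y → A (x ⊕ (d ⊙ y))) (toList P)) (List.map (λ z → z ⊖ (d ⊙ List⁺.head P)) (box N r))

patternBases-unique : ∀ {r} N (P : List⁺ (Pt r)) A d → Unique (patternBases N P A d)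
patternBases-unique {r} N P A d = Unique.filter⁺ _ (Unique.map⁺ (⊖-cancelʳ _) (box-unique N r))

∈-patternBases⁻ : ∀ {r N} {P : List⁺ (Pt r)} {A d x} → x ∈ patternBases N P A d →
  ∀ {y} → y ∈ toList P → T (A (x ⊕ (d ⊙ y)))
∈-patternBases⁻ {r} {N} {P} {A} {d} {x} x∈ =
  All.lookup (All.all⁺ (λ y → A (x ⊕ (d ⊙ y))) (toList P)
    (proj₂ (∈.∈-filter⁻ _ {xs = List.map (λ z → z ⊖ (d ⊙ List⁺.head P)) (box N r)} x∈)))

∈-patternBases⁺ : ∀ {r N} {P : List⁺ (Pt r)} {A d} x → x ⊕ (d ⊙ List⁺.head P) ∈ box N r →
  (∀ {y} → y ∈ toList P → T (A (x ⊕ (d ⊙ y)))) → x ∈ patternBases N P A d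
∈-patternBases⁺ {P = P} {A} {d} x x+dy₀∈box isPattern = ∈.∈-filter⁺ _
  (subst (_∈ _) (⊕-⊖ x (d ⊙ List⁺.head P)) (∈.∈-map⁺ (_⊖ (d ⊙ List⁺.head P)) x+dy₀∈box))
  (All.all⁻ (λ y → A (x ⊕ (d ⊙ y))) (All.tabulate isPattern))

∈-─ : ∀ {A : Set} {x y : A} {ys} (y∈ys : y ∈ ys) → x ∈ ys → x ≢ y → x ∈ ys ─ y∈ys
∈-─ (here refl) (here refl) x≢y = contradiction refl x≢y
∈-─ (here refl) (there x∈)  x≢y = x∈
∈-─ (there y∈)  (here refl) x≢y = here refl
∈-─ (there y∈)  (there x∈)  x≢y = there (∈-─ y∈ x∈ x≢y)

length-mono-⊆ : ∀ {A : Set} {xs ys : List A} → Unique xs → xs ⊆ ys → length xs ℕ.≤ length ys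
length-mono-⊆ {xs = []}     _             _     = ℕ.z≤n
length-mono-⊆ {xs = x ∷ xs} {ys} (x∉xs AllPairs.∷ xs!) x∷xs⊆ys =
  subst (suc (length xs) ℕ.≤_) (sym (List.length-removeAt′ ys (index x∈ys)))
    (ℕ.s≤s (length-mono-⊆ xs! λ x′∈xs → ∈-─ x∈ys (x∷xs⊆ys (there x′∈xs)) (All.lookup x∉xs x′∈xs ∘ sym)))
  where
  x∈ys = x∷xs⊆ys (here refl)

sumBelow : ℕ → (ℕ → ℕ) → ℕ
sumBelow zero    f = 0
sumBelow (suc m) f = sumBelow m f ℕ.+ f m

sumBelow-cong : ∀ m {f g} → (∀ j → f j ≡ g j) → sumBelow m f ≡ sumBelow m g
sumBelow-cong zero    f≗g = refl
sumBelow-cong (suc m) f≗g = cong₂ ℕ._+_ (sumBelow-cong m f≗g) (f≗g m)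

sumBelow-+ : ∀ m f g → sumBelow m (λ j → f j ℕ.+ g j) ≡ sumBelow m f ℕ.+ sumBelow m g
sumBelow-+ zero    f g = refl
sumBelow-+ (suc m) f g rewrite sumBelow-+ m f g =
  interchange (sumBelow m f) (sumBelow m g) (f m) (g m)
  where
  interchange : ∀ a b c d → a ℕ.+ b ℕ.+ (c ℕ.+ d) ≡ a ℕ.+ c ℕ.+ (b ℕ.+ d)
  interchange = ℕ-Solver.solve-∀

sumBelow-zero : ∀ m → sumBelow m (λ _ → 0) ≡ 0
sumBelow-zero zero    = refl
sumBelow-zero (suc m) = cong (ℕ._+ 0) (sumBelow-zero m)

indicator : Bool → ℕ
indicator b = if b then 1 else 0

sumBelow-indicator-≥ : ∀ m c → m ℕ.≤ c → sumBelow m (λ j → indicator (does (c ℕ.≟ j))) ≡ 0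
sumBelow-indicator-≥ zero    c _   = refl
sumBelow-indicator-≥ (suc m) c m<c = cong₂ ℕ._+_ (sumBelow-indicator-≥ m c (ℕ.<⇒≤ m<c))
  (cong indicator (dec-false (c ℕ.≟ m) (ℕ.>⇒≢ m<c)))

sumBelow-indicator : ∀ m c → c ℕ.< m → sumBelow m (λ j → indicator (does (c ℕ.≟ j))) ≡ 1
sumBelow-indicator (suc m) c c<1+m with c ℕ.≟ m
... | yes refl = cong₂ ℕ._+_ (sumBelow-indicator-≥ m c ℕ.≤-refl) (cong indicator (dec-true (c ℕ.≟ c) refl))
... | no c≢m   = cong₂ ℕ._+_ (sumBelow-indicator m c (ℕ.≤∧≢⇒< (ℕ.s≤s⁻¹ c<1+m) c≢m))
  (cong indicator (dec-false (c ℕ.≟ m) c≢m))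

sumBelow-indicator-∧ : ∀ m b c → c ℕ.< m → sumBelow m (λ j → indicator (b ∧ does (c ℕ.≟ j))) ≡ indicator b
sumBelow-indicator-∧ m true  c c<m = sumBelow-indicator m c c<m
sumBelow-indicator-∧ m false c c<m = sumBelow-zero m

length-filterᵇ-∷ : ∀ {A : Set} (p : A → Bool) x xs →
  length (filterᵇ p (x ∷ xs)) ≡ indicator (p x) ℕ.+ length (filterᵇ p xs)
length-filterᵇ-∷ p x xs with p x
... | true  = refl
... | false = refl

length-filterᵇ-partition : ∀ {A : Set} (p : A → Bool) (colour : A → ℕ) m → (∀ x → colour x ℕ.< m) → ∀ xs →
  sumBelow m (λ j → length (filterᵇ (λ x → p x ∧ does (colour x ℕ.≟ j)) xs)) ≡ length (filterᵇ p xs)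
length-filterᵇ-partition p colour m colour<m []       = sumBelow-zero m
length-filterᵇ-partition p colour m colour<m (x ∷ xs) = begin
  sumBelow m (λ j → length (filterᵇ (p∧colour≡ j) (x ∷ xs)))
    ≡⟨ sumBelow-cong m (λ j → length-filterᵇ-∷ (p∧colour≡ j) x xs) ⟩
  sumBelow m (λ j → indicator (p∧colour≡ j x) ℕ.+ length (filterᵇ (p∧colour≡ j) xs))
    ≡⟨ sumBelow-+ m (λ j → indicator (p∧colour≡ j x)) (λ j → length (filterᵇ (p∧colour≡ j) xs)) ⟩
  sumBelow m (λ j → indicator (p∧colour≡ j x)) ℕ.+ sumBelow m (λ j → length (filterᵇ (p∧colour≡ j) xs))
    ≡⟨ cong₂ ℕ._+_ (sumBelow-indicator-∧ m (p x) (colour x) (colour<m x))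
                   (length-filterᵇ-partition p colour m colour<m xs) ⟩
  indicator (p x) ℕ.+ length (filterᵇ p xs)
    ≡⟨ length-filterᵇ-∷ p x xs ⟨
  length (filterᵇ p (x ∷ xs)) ∎
  where
  open ≡-Reasoning
  p∧colour≡ : ℕ → _ → Bool
  p∧colour≡ j x = p x ∧ does (colour x ℕ.≟ j)

pigeonhole : ∀ m f → 0 ℕ.< m → ∃ λ j → j ℕ.< m × sumBelow m f ℕ.≤ m ℕ.* f j
pigeonhole (suc zero)    f _ = 0 , ℕ.≤-refl , ℕ.≤-reflexive (sym (ℕ.+-identityʳ (f 0)))
pigeonhole (suc (suc m)) f _ with j , j<1+m , sum≤ ← pigeonhole (suc m) f (ℕ.s≤s ℕ.z≤n)
  with ℕ.≤-total (f j) (f (suc m))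
... | inj₁ fj≤fm = suc m , ℕ.≤-refl , (begin
  sumBelow (suc m) f ℕ.+ f (suc m)   ≤⟨ ℕ.+-monoˡ-≤ (f (suc m)) sum≤ ⟩
  suc m ℕ.* f j ℕ.+ f (suc m)        ≤⟨ ℕ.+-monoˡ-≤ (f (suc m)) (ℕ.*-monoʳ-≤ (suc m) fj≤fm) ⟩
  suc m ℕ.* f (suc m) ℕ.+ f (suc m)  ≡⟨ ℕ.+-comm (suc m ℕ.* f (suc m)) (f (suc m)) ⟩
  suc (suc m) ℕ.* f (suc m)          ∎)
  where open ℕ.≤-Reasoning
... | inj₂ fm≤fj = j , ℕ.m≤n⇒m≤1+n j<1+m , (begin
  sumBelow (suc m) f ℕ.+ f (suc m)   ≤⟨ ℕ.+-monoˡ-≤ (f (suc m)) sum≤ ⟩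
  suc m ℕ.* f j ℕ.+ f (suc m)        ≤⟨ ℕ.+-monoʳ-≤ (suc m ℕ.* f j) fm≤fj ⟩
  suc m ℕ.* f j ℕ.+ f j              ≡⟨ ℕ.+-comm (suc m ℕ.* f j) (f j) ⟩
  suc (suc m) ℕ.* f j                ∎)
  where open ℕ.≤-Reasoning

-- Clearing denominators of an affine map

module AffineEmbedding {r} (M : Mat r) (b : Vec ℚ r) {M′ : Mat r} (M′M≡I : M′ ·m M ≡ identityMat r) where

  k : ℕ
  k = matDenominator M

  instance
    k-nonZero : ℕ.NonZero k
    k-nonZero = matDenominator-nonZero M

  L : Vec (Vec ℤ r) r
  L = map (map (clear k)) M

  ι-L·ℤ : ∀ a i → ι (lookup (L ·ℤ a) i) ≡ ℕ→ℚ k * dot (lookup M i) (toℚv a)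
  ι-L·ℤ a i = begin
    ι (lookup (L ·ℤ a) i)                        ≡⟨ cong ι (Vec.lookup-map i (λ row → dotℤ row a) L) ⟩
    ι (dotℤ (lookup L i) a)                      ≡⟨ ι-dotℤ (lookup L i) a ⟩
    dot (toℚv (lookup L i)) (toℚv a)             ≡⟨ cong (λ row → dot row (toℚv a)) toℚv-Lᵢ ⟩
    dot (map (ℕ→ℚ k *_) (lookup M i)) (toℚv a)   ≡⟨ dot-scaleˡ (ℕ→ℚ k) (lookup M i) (toℚv a) ⟩
    ℕ→ℚ k * dot (lookup M i) (toℚv a)            ∎
    where
    open ≡-Reasoning
    toℚv-Lᵢ : toℚv (lookup L i) ≡ map (ℕ→ℚ k *_) (lookup M i)
    toℚv-Lᵢ = vecExt λ j → begin
      lookup (toℚv (lookup L i)) j              ≡⟨ Vec.lookup-map j ι (lookup L i) ⟩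
      ι (lookup (lookup L i) j)                 ≡⟨ cong (λ row → ι (lookup row j)) (Vec.lookup-map i (map (clear k)) M) ⟩
      ι (lookup (map (clear k) (lookup M i)) j) ≡⟨ cong ι (Vec.lookup-map j (clear k) (lookup M i)) ⟩
      ι (clear k (lookup (lookup M i) j))       ≡⟨ ι-clear k _ (∣-trans (↧-∣-denominator (lookup M i) j)
                                                                  (denominator-∣-matDenominator M i)) ⟩
      ℕ→ℚ k * lookup (lookup M i) j             ≡⟨ Vec.lookup-map j (ℕ→ℚ k *_) (lookup M i) ⟨
      lookup (map (ℕ→ℚ k *_) (lookup M i)) j    ∎

  rows-injective : ∀ {u v} → (∀ i → ℕ→ℚ k * dot (lookup M i) u ≡ ℕ→ℚ k * dot (lookup M i) v) → u ≡ v
  rows-injective {u} {v} kMu≡kMv = ·v-injective {M = M} M′M≡I (vecExt λ i → begin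
    lookup (M ·v u) i      ≡⟨ Vec.lookup-map i (λ row → dot row u) M ⟩
    dot (lookup M i) u     ≡⟨ ℕ→ℚ-*-cancelˡ-≡ k (kMu≡kMv i) ⟩
    dot (lookup M i) v     ≡⟨ Vec.lookup-map i (λ row → dot row v) M ⟨
    lookup (M ·v v) i      ∎)
    where open ≡-Reasoning

  L·ℤ-injective : ∀ {a a′} → L ·ℤ a ≡ L ·ℤ a′ → a ≡ a′
  L·ℤ-injective {a} {a′} La≡La′ = toℚv-injective (rows-injective λ i →
    trans (sym (ι-L·ℤ a i)) (trans (cong (λ v → ι (lookup v i)) La≡La′) (ι-L·ℤ a′ i)))

  R : ℕ
  R = matNorm₁ L

  K : ℕ
  K = suc (R ℕ.+ R)

  offset : ℕ → ℕ
  offset N = suc (R ℕ.* N)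

  embed : ℕ → Pt r → Pt r
  embed N a = (L ·ℤ a) ⊕ replicate r (+ offset N)

  lookup-embed : ∀ N a i → lookup (embed N a) i ≡ lookup (L ·ℤ a) i ℤ.+ + offset N
  lookup-embed N a i = trans (Vec.lookup-zipWith ℤ._+_ i (L ·ℤ a) _)
    (cong (ℤ._+_ (lookup (L ·ℤ a) i)) (Vec.lookup-replicate i _))

  embed-injective : ∀ N {a a′} → embed N a ≡ embed N a′ → a ≡ a′
  embed-injective N = L·ℤ-injective ∘ ⊕-cancelʳ (replicate r (+ offset N))

  embed-box : ∀ {N a} → 1 ℕ.≤ N → a ∈ box N r → embed N a ∈ box (K ℕ.* N) r
  embed-box {N} {a} 1≤N a∈box = ∈-box⁺ (embed N a) λ i →
    subst (InRange (K ℕ.* N)) (sym (lookup-embed N a i))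
      (InRange-mono RN+offset≤KN (∣∣≤⇒InRange-shift {z = lookup (L ·ℤ a) i}
        (∣·ℤ∣≤matNorm₁*bound N L a (InRange⇒∣∣≤ ∘ ∈-box⁻ a∈box) i)))
    where
    RN+offset≤KN : R ℕ.* N ℕ.+ offset N ℕ.≤ K ℕ.* N
    RN+offset≤KN = begin
      R ℕ.* N ℕ.+ suc (R ℕ.* N)     ≡⟨ ℕ.+-suc (R ℕ.* N) (R ℕ.* N) ⟩
      suc (R ℕ.* N ℕ.+ R ℕ.* N)     ≡⟨ cong suc (ℕ.*-distribʳ-+ N R R) ⟨
      suc ((R ℕ.+ R) ℕ.* N)         ≤⟨ ℕ.+-monoˡ-≤ ((R ℕ.+ R) ℕ.* N) 1≤N ⟩
      N ℕ.+ (R ℕ.+ R) ℕ.* N         ∎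
      where open ℕ.≤-Reasoning

  φ : Pt r → Vec ℚ r
  φ y = affine M b (toℚv y)

  lookup-φ : ∀ y i → lookup (φ y) i ≡ dot (lookup M i) (toℚv y) + lookup b i
  lookup-φ y i = trans (Vec.lookup-zipWith _+_ i (M ·v toℚv y) b)
    (cong (_+ lookup b i) (Vec.lookup-map i (λ row → dot row (toℚv y)) M))

  φ-injective : ∀ {y y′} → φ y ≡ φ y′ → y ≡ y′
  φ-injective {y} {y′} φy≡φy′ = toℚv-injective (rows-injective λ i → cong (ℕ→ℚ k *_) (begin
    dot (lookup M i) (toℚv y)                             ≡⟨ +-cancelʳ _ (lookup b i) ⟨
    dot (lookup M i) (toℚv y) + lookup b i - lookup b i   ≡⟨ cong (_- lookup b i) (lookup-φ y i) ⟨
    lookup (φ y) i - lookup b i                           ≡⟨ cong (λ v → lookup v i - lookup b i) φy≡φy′ ⟩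
    lookup (φ y′) i - lookup b i                          ≡⟨ cong (_- lookup b i) (lookup-φ y′ i) ⟩
    dot (lookup M i) (toℚv y′) + lookup b i - lookup b i  ≡⟨ +-cancelʳ _ (lookup b i) ⟩
    dot (lookup M i) (toℚv y′)                            ∎))
    where
    open ≡-Reasoning
    +-cancelʳ : ∀ x c → x + c - c ≡ x
    +-cancelʳ = solve-∀ ℚ-ring

  -- The right-hand side does not involve the pattern point (y, q, a), so all the points of a
  -- Q-pattern of scale d′ = d k pull back to a single P-pattern of scale d.
  pattern-invariant : ∀ N z d d′ {y q a} → d′ ≡ d ℤ.* + k → φ y ≡ toℚv q → embed N a ≡ z ⊕ (d′ ⊙ q) → ∀ i →
    ℕ→ℚ k * dot (lookup M i) (toℚv (a ⊖ (d ⊙ y))) ≡ ι (lookup z i) + ι d′ * lookup b i - ℕ→ℚ (offset N)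
  pattern-invariant N z d d′ {y} {q} {a} d′≡dk φy≡q embed≡ i = begin
    ℕ→ℚ k * dot Mᵢ (toℚv (a ⊖ (d ⊙ y)))       ≡⟨ cong (ℕ→ℚ k *_) (dot-toℚv-⊖ Mᵢ a y d) ⟩
    ℕ→ℚ k * (A - ι d * Y)                      ≡⟨ expand (ℕ→ℚ k) A O (ι d) Y ⟩
    (ℕ→ℚ k * A + O) - O - ι d * ℕ→ℚ k * Y      ≡⟨ cong₂ (λ u w → u - O - w * Y) embedᵢ dk≡d′ ⟩
    (ι zᵢ + ι d′ * ι qᵢ) - O - ι d′ * Y        ≡⟨ cong (λ w → (ι zᵢ + ι d′ * w) - O - ι d′ * Y) φyᵢ ⟨
    (ι zᵢ + ι d′ * (Y + bᵢ)) - O - ι d′ * Y    ≡⟨ collect (ι zᵢ) (ι d′) Y bᵢ O ⟩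
    ι zᵢ + ι d′ * bᵢ - O                        ∎
    where
    open ≡-Reasoning
    Mᵢ = lookup M i
    A  = dot Mᵢ (toℚv a)
    Y  = dot Mᵢ (toℚv y)
    O  = ℕ→ℚ (offset N)
    zᵢ = lookup z i
    qᵢ = lookup q i
    bᵢ = lookup b i
    expand : ∀ κ A O D Y → κ * (A - D * Y) ≡ (κ * A + O) - O - D * κ * Y
    expand = solve-∀ ℚ-ring
    collect : ∀ Z D Y B O → (Z + D * (Y + B)) - O - D * Y ≡ Z + D * B - O
    collect = solve-∀ ℚ-ring
    embedᵢ : ℕ→ℚ k * A + O ≡ ι zᵢ + ι d′ * ι qᵢ
    embedᵢ = begin
      ℕ→ℚ k * A + O                        ≡⟨ cong (_+ O) (ι-L·ℤ a i) ⟨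
      ι (lookup (L ·ℤ a) i) + O            ≡⟨ ι-homo-+ (lookup (L ·ℤ a) i) (+ offset N) ⟨
      ι (lookup (L ·ℤ a) i ℤ.+ + offset N)  ≡⟨ cong ι (lookup-embed N a i) ⟨
      ι (lookup (embed N a) i)             ≡⟨ cong (λ v → ι (lookup v i)) embed≡ ⟩
      ι (lookup (z ⊕ (d′ ⊙ q)) i)          ≡⟨ cong ι (lookup-⊕-⊙ z d′ q i) ⟩
      ι (zᵢ ℤ.+ d′ ℤ.* qᵢ)                 ≡⟨ ι-homo-+ zᵢ (d′ ℤ.* qᵢ) ⟩
      ι zᵢ + ι (d′ ℤ.* qᵢ)                 ≡⟨ cong (_+_ (ι zᵢ)) (ι-homo-* d′ qᵢ) ⟩
      ι zᵢ + ι d′ * ι qᵢ                   ∎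
    dk≡d′ : ι d * ℕ→ℚ k ≡ ι d′
    dk≡d′ = trans (sym (ι-homo-* d (+ k))) (cong ι (sym d′≡dk))
    φyᵢ : Y + bᵢ ≡ ι qᵢ
    φyᵢ = trans (sym (lookup-φ y i)) (trans (cong (λ v → lookup v i) φy≡q) (Vec.lookup-map i ι q))

  pattern-pullback : ∀ N z d d′ {y q a y₀ q₀ a₀} → d′ ≡ d ℤ.* + k →
    φ y ≡ toℚv q → embed N a ≡ z ⊕ (d′ ⊙ q) → φ y₀ ≡ toℚv q₀ → embed N a₀ ≡ z ⊕ (d′ ⊙ q₀) →
    a ≡ (a₀ ⊖ (d ⊙ y₀)) ⊕ (d ⊙ y)
  pattern-pullback N z d d′ {y} {q} {a} {y₀} {q₀} {a₀} d′≡dk φy≡q embed-a φy₀≡q₀ embed-a₀ = begin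
    a                              ≡⟨ ⊖-⊕ a (d ⊙ y) ⟨
    (a ⊖ (d ⊙ y)) ⊕ (d ⊙ y)        ≡⟨ cong (_⊕ (d ⊙ y)) same-base ⟩
    (a₀ ⊖ (d ⊙ y₀)) ⊕ (d ⊙ y)      ∎
    where
    open ≡-Reasoning
    same-base : a ⊖ (d ⊙ y) ≡ a₀ ⊖ (d ⊙ y₀)
    same-base = toℚv-injective (rows-injective λ i →
      trans (pattern-invariant N z d d′ d′≡dk φy≡q embed-a i)
            (sym (pattern-invariant N z d d′ d′≡dk φy₀≡q₀ embed-a₀ i)))

  single-point-pullback : ∀ N z d d′ {y q a y₀ q₀ a₀} → q ≡ q₀ →
    φ y ≡ toℚv q → embed N a ≡ z ⊕ (d′ ⊙ q) → φ y₀ ≡ toℚv q₀ → embed N a₀ ≡ z ⊕ (d′ ⊙ q₀) →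
    a ≡ (a₀ ⊖ (d ⊙ y₀)) ⊕ (d ⊙ y)
  single-point-pullback N z d d′ {y} {q} {a} {y₀} {q₀} {a₀} q≡q₀ φy≡q embed-a φy₀≡q₀ embed-a₀ = begin
    a                              ≡⟨ embed-injective N embed-a≡embed-a₀ ⟩
    a₀                             ≡⟨ ⊖-⊕ a₀ (d ⊙ y₀) ⟨
    (a₀ ⊖ (d ⊙ y₀)) ⊕ (d ⊙ y₀)     ≡⟨ cong (λ v → (a₀ ⊖ (d ⊙ y₀)) ⊕ (d ⊙ v)) y≡y₀ ⟨
    (a₀ ⊖ (d ⊙ y₀)) ⊕ (d ⊙ y)      ∎
    where
    open ≡-Reasoning
    embed-a≡embed-a₀ : embed N a ≡ embed N a₀
    embed-a≡embed-a₀ = trans embed-a (trans (cong (λ v → z ⊕ (d′ ⊙ v)) q≡q₀) (sym embed-a₀))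
    y≡y₀ : y ≡ y₀
    y≡y₀ = φ-injective (trans φy≡q (trans (cong toℚv q≡q₀) (sym φy₀≡q₀)))

  module ResidueColouring {q₁ q₀ : Pt r} (i₀ : Fin r) (q₁≢q₀ : lookup q₁ i₀ ≢ lookup q₀ i₀) where

    gap : ℤ
    gap = lookup q₁ i₀ ℤ.- lookup q₀ i₀

    instance
      ∣gap∣-nonZero : ℕ.NonZero ℤ.∣ gap ∣
      ∣gap∣-nonZero = ℕ.≢-nonZero (q₁≢q₀ ∘ ℤ.i-j≡0⇒i≡j _ _ ∘ ℤ.∣i∣≡0⇒i≡0)

    classes : ℕ
    classes = k ℕ.* ℤ.∣ gap ∣

    instance
      classes-nonZero : ℕ.NonZero classes
      classes-nonZero = ℕ.m*n≢0 k ℤ.∣ gap ∣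

    colour : ℕ → Pt r → ℕ
    colour N a = lookup (embed N a) i₀ ℤ.%ℕ classes

    colour<classes : ∀ N a → colour N a ℕ.< classes
    colour<classes N a = ℤ.n%ℕd<d (lookup (embed N a) i₀) classes

    -- Coordinate i₀ of the two pattern points differs by d′·gap, and also by a multiple of k·|gap|.
    sameColour⇒k∣d′ : ∀ {N z d′ a₁ a₀} → embed N a₁ ≡ z ⊕ (d′ ⊙ q₁) → embed N a₀ ≡ z ⊕ (d′ ⊙ q₀) →
      colour N a₁ ≡ colour N a₀ → k ∣ ℤ.∣ d′ ∣
    sameColour⇒k∣d′ {N} {z} {d′} {a₁} {a₀} embed-a₁ embed-a₀ same = ℕ.*-cancelʳ-∣ ℤ.∣ gap ∣ (begin
      k ℕ.* ℤ.∣ gap ∣       ∣⟨ %ℕ-≡⇒∣∣-∣ w₁ w₀ classes same ⟩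
      ℤ.∣ w₁ ℤ.- w₀ ∣       ≡⟨ cong ℤ.∣_∣ w₁-w₀≡d′*gap ⟩
      ℤ.∣ d′ ℤ.* gap ∣      ≡⟨ ℤ.abs-* d′ gap ⟩
      ℤ.∣ d′ ∣ ℕ.* ℤ.∣ gap ∣ ∎)
      where
      open ∣-Reasoning
      w₁ = lookup (embed N a₁) i₀
      w₀ = lookup (embed N a₀) i₀
      factor : ∀ z d x y → (z ℤ.+ d ℤ.* x) ℤ.- (z ℤ.+ d ℤ.* y) ≡ d ℤ.* (x ℤ.- y)
      factor = ℤ-Solver.solve-∀
      w₁-w₀≡d′*gap : w₁ ℤ.- w₀ ≡ d′ ℤ.* gap
      w₁-w₀≡d′*gap = trans
        (cong₂ ℤ._-_ (trans (cong (λ v → lookup v i₀) embed-a₁) (lookup-⊕-⊙ z d′ q₁ i₀))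
                     (trans (cong (λ v → lookup v i₀) embed-a₀) (lookup-⊕-⊙ z d′ q₀ i₀)))
        (factor (lookup z i₀) d′ (lookup q₁ i₀) (lookup q₀ i₀))

  image : ℕ → (Pt r → Bool) → Pt r → Bool
  image N B w = any (λ a → B a ∧ isYes (embed N a ≟ₚ w)) (box N r)

  image⁻ : ∀ {N B w} → T (image N B w) → ∃ λ a → a ∈ box N r × T (B a) × embed N a ≡ w
  image⁻ {N} {B} {w} w∈image
    with a , a∈box , Ba∧embed≡ ← find (Any.any⁻ _ (box N r) w∈image)
    with Ba , embed≡ ← Equivalence.to T-∧ Ba∧embed≡ = a , a∈box , Ba , toWitness {a? = embed N a ≟ₚ w} embed≡

  image⁺ : ∀ {N B a} → a ∈ box N r → T (B a) → T (image N B (embed N a))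
  image⁺ a∈box Ba = Any.any⁺ _ (lose a∈box (Equivalence.from T-∧ (Ba , fromWitness refl)))

  image-⊆-box : ∀ {N} B → 1 ℕ.≤ N → SubsetOfBox (K ℕ.* N) (image N B)
  image-⊆-box B 1≤N w w∈image with _ , a∈box , _ , refl ← image⁻ {B = B} (Equivalence.from T-≡ w∈image) =
    embed-box 1≤N a∈box

  card≤card-image : ∀ {N} B → 1 ℕ.≤ N → card N B ℕ.≤ card (K ℕ.* N) (image N B)
  card≤card-image {N} B 1≤N = begin
    length (filterᵇ B (box N r))                             ≡⟨ List.length-map (embed N) (filterᵇ B (box N r)) ⟨
    length (List.map (embed N) (filterᵇ B (box N r)))        ≤⟨ length-mono-⊆ unique image⊆ ⟩
    length (filterᵇ (image N B) (box (K ℕ.* N) r))           ∎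
    where
    open ℕ.≤-Reasoning
    unique = Unique.map⁺ (embed-injective N) (Unique.filter⁺ _ (box-unique N r))
    image⊆ : List.map (embed N) (filterᵇ B (box N r)) ⊆ filterᵇ (image N B) (box (K ℕ.* N) r)
    image⊆ w∈ with a , a∈ , refl ← ∈.∈-map⁻ (embed N) w∈ with a∈box , Ba ← ∈.∈-filter⁻ _ {xs = box N r} a∈ =
      ∈.∈-filter⁺ _ (embed-box 1≤N a∈box) (image⁺ a∈box Ba)

-- Transferring patterns from Q to P

module Transfer {r} (P Q : List⁺ (Pt r)) (M : Mat r) (b : Vec ℚ r) {M′ : Mat r} (M′M≡I : M′ ·m M ≡ identityMat r)
  (φP⊆Q : ∀ y → y ∈ toList P → ∃ λ q → q ∈ toList Q × affine M b (toℚv y) ≡ toℚv q) where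

  open AffineEmbedding M b M′M≡I

  SinglePoint : Set
  SinglePoint = ∀ {q} → q ∈ toList Q → q ≡ List⁺.head Q

  Monochromatic : (ℕ → Pt r → ℕ) → ℕ → Pt r → ℤ → Set
  Monochromatic colour N z d′ =
    ∃ λ j → ∀ {q} → q ∈ toList Q → ∃ λ a → colour N a ≡ j × embed N a ≡ z ⊕ (d′ ⊙ q)

  record Colouring : Set where
    field
      classes        : ℕ
      colour         : ℕ → Pt r → ℕ
      classes-pos    : 0 ℕ.< classes
      colour<classes : ∀ N a → colour N a ℕ.< classes
      -- No colouring detects the scale of a single-point pattern, but then every scale pulls back.
      detects-scale  : SinglePoint ⊎ (∀ {N z d′} → Monochromatic colour N z d′ → k ∣ ℤ.∣ d′ ∣)

  colouring : Colouring
  colouring with All.all? (_≟ₚ List⁺.head Q) (toList Q)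
  ... | yes all≡q₀ = record
    { classes = 1 ; colour = λ _ _ → 0 ; classes-pos = ℕ.≤-refl ; colour<classes = λ _ _ → ℕ.≤-refl
    ; detects-scale = inj₁ (All.lookup all≡q₀) }
  ... | no ¬all≡q₀
    with q₁ , q₁∈Q , q₁≢q₀ ← find (All.¬All⇒Any¬ (_≟ₚ List⁺.head Q) (toList Q) ¬all≡q₀)
    with i₀ , q₁ᵢ₀≢q₀ᵢ₀ ← vec-≢⇒lookup-≢ q₁≢q₀ = record
    { classes = classes ; colour = colour ; classes-pos = ℕ.>-nonZero⁻¹ classes ; colour<classes = colour<classes
    ; detects-scale = inj₂ λ {_} {_} {d′} (j , class-j) →
        let a₁ , colour-a₁ , embed-a₁ = class-j q₁∈Q
            a₀ , colour-a₀ , embed-a₀ = class-j (here refl)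
        in sameColour⇒k∣d′ {d′ = d′} embed-a₁ embed-a₀ (trans colour-a₁ (sym colour-a₀)) }
    where open ResidueColouring {q₁} {List⁺.head Q} i₀ q₁ᵢ₀≢q₀ᵢ₀

  open Colouring colouring

  -- d′ / k; the junk value 1 when k ∤ d′ is only ever used for a single-point Q.
  scale : ℤ → ℤ
  scale d′ with k ℕ.∣? ℤ.∣ d′ ∣
  ... | yes (divides q _) = ℤ.sign d′ ℤ.◃ q
  ... | no _              = + 1

  scale-spec : ∀ d′ → k ∣ ℤ.∣ d′ ∣ → d′ ≡ scale d′ ℤ.* + k
  scale-spec d′ k∣d′ with k ℕ.∣? ℤ.∣ d′ ∣
  ... | yes (divides q ∣d′∣≡qk) = sign◃-quotient d′ q k ∣d′∣≡qk
  ... | no k∤d′                 = contradiction k∣d′ k∤d′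

  scale-nonZero : ∀ {d′} → d′ ≢ + 0 → scale d′ ≢ + 0
  scale-nonZero {d′} d′≢0 with k ℕ.∣? ℤ.∣ d′ ∣
  ... | yes (divides q ∣d′∣≡qk) = λ scale≡0 →
    d′≢0 (trans (sign◃-quotient d′ q k ∣d′∣≡qk) (trans (cong (ℤ._* + k) scale≡0) (ℤ.*-zeroˡ (+ k))))
  ... | no _                    = λ ()

  monochromatic-pullback : ∀ {N z d′} → Monochromatic colour N z d′ →
    ∀ {y q a y₀ q₀ a₀} → q ∈ toList Q → q₀ ∈ toList Q →
    φ y ≡ toℚv q → embed N a ≡ z ⊕ (d′ ⊙ q) → φ y₀ ≡ toℚv q₀ → embed N a₀ ≡ z ⊕ (d′ ⊙ q₀) →
    a ≡ (a₀ ⊖ (scale d′ ⊙ y₀)) ⊕ (scale d′ ⊙ y)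
  monochromatic-pullback {N} {z} {d′} mono q∈Q q₀∈Q with detects-scale
  ... | inj₂ detects = pattern-pullback N z (scale d′) d′ (scale-spec d′ (detects {N} {z} {d′} mono))
  ... | inj₁ single  = single-point-pullback N z (scale d′) d′ (trans (single q∈Q) (sym (single q₀∈Q)))

  colourClass : ℕ → (Pt r → Bool) → ℕ → Pt r → Bool
  colourClass N A j a = A a ∧ does (colour N a ℕ.≟ j)

  popular-colour : ∀ N A → ∃ λ j → card N A ℕ.≤ classes ℕ.* card N (colourClass N A j)
  popular-colour N A with j , _ , sum≤ ← pigeonhole classes (λ j → card N (colourClass N A j)) classes-pos =
    j , subst (ℕ._≤ classes ℕ.* card N (colourClass N A j))
              (length-filterᵇ-partition A (colour N) classes (colour<classes N) (box N r)) sum≤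

  countPattern-transfer : ∀ N A j d′ →
    countPattern (K ℕ.* N) Q (image N (colourClass N A j)) d′ ℕ.≤ countPattern N P A (scale d′)
  countPattern-transfer N A j d′ = begin
    length (patternBases (K ℕ.* N) Q Ã d′)        ≤⟨ length-mono-⊆ (patternBases-unique (K ℕ.* N) Q Ã d′) bases⊆ ⟩
    length (List.map g (patternBases N P A d))    ≡⟨ List.length-map g (patternBases N P A d) ⟩
    length (patternBases N P A d)                 ∎
    where
    open ℕ.≤-Reasoning
    Ã = image N (colourClass N A j)
    d = scale d′
    y₀ = List⁺.head P
    q₀ = proj₁ (φP⊆Q y₀ (here refl))
    q₀∈Q = proj₁ (proj₂ (φP⊆Q y₀ (here refl)))
    φy₀≡q₀ = proj₂ (proj₂ (φP⊆Q y₀ (here refl)))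
    g : Pt r → Pt r
    g x = embed N (x ⊕ (d ⊙ y₀)) ⊖ (d′ ⊙ q₀)
    bases⊆ : patternBases (K ℕ.* N) Q Ã d′ ⊆ List.map g (patternBases N P A d)
    bases⊆ {z} z∈ = subst (_∈ _) gx≡z (∈.∈-map⁺ g x∈)
      where
      preimage : ∀ {q} → q ∈ toList Q → ∃ λ a → a ∈ box N r × T (colourClass N A j a) × embed N a ≡ z ⊕ (d′ ⊙ q)
      preimage q∈Q = image⁻ (∈-patternBases⁻ {A = Ã} {d = d′} z∈ q∈Q)
      mono : Monochromatic colour N z d′
      mono = j , λ q∈Q → let a , _ , Aa∧colour≡j , embed-a = preimage q∈Q
                          in a , ℕ.≡ᵇ⇒≡ _ j (proj₂ (Equivalence.to T-∧ Aa∧colour≡j)) , embed-a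
      a₀ = proj₁ (preimage q₀∈Q)
      a₀∈box = proj₁ (proj₂ (preimage q₀∈Q))
      embed-a₀ = proj₂ (proj₂ (proj₂ (preimage q₀∈Q)))
      x = a₀ ⊖ (d ⊙ y₀)
      x∈ : x ∈ patternBases N P A d
      x∈ = ∈-patternBases⁺ {A = A} {d = d} x (subst (_∈ box N r) (sym (⊖-⊕ a₀ (d ⊙ y₀))) a₀∈box) λ {y} y∈P →
        let q , q∈Q , φy≡q = φP⊆Q y y∈P
            a , _ , Aa∧colour≡j , embed-a = preimage q∈Q
        in subst (T ∘ A) (monochromatic-pullback {N} {z} {d′} mono q∈Q q₀∈Q φy≡q embed-a φy₀≡q₀ embed-a₀)
                 (proj₁ (Equivalence.to T-∧ Aa∧colour≡j))
      gx≡z : g x ≡ z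
      gx≡z = trans (cong (λ a → embed N a ⊖ (d′ ⊙ q₀)) (⊖-⊕ a₀ (d ⊙ y₀)))
                   (trans (cong (_⊖ (d′ ⊙ q₀)) embed-a₀) (⊕-⊖ z (d′ ⊙ q₀)))

  E : ℕ
  E = K ℕ.^ r ℕ.* classes

  instance
    E-nonZero : ℕ.NonZero E
    E-nonZero = ℕ.m*n≢0 (K ℕ.^ r) classes {{ℕ.m^n≢0 K r}} {{ℕ.>-nonZero classes-pos}}

  -- 1/(E + 1) rather than 1/E so that c < 1 also when E = 1.
  c : ℚ
  c = 1/suc E

  dense-colourClass-image : ∀ α N A → 1 ℕ.≤ N → α * ℕ→ℚ (N ℕ.^ r) ≤ ℕ→ℚ (card N A) →
    ∃ λ j → c * α * ℕ→ℚ ((K ℕ.* N) ℕ.^ r) ≤ ℕ→ℚ (card (K ℕ.* N) (image N (colourClass N A j)))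
  dense-colourClass-image α N A 1≤N A-dense =
    let j , A≤classes*Aj = popular-colour N A
        Ã = image N (colourClass N A j)
    in j , subst (λ n → c * α * ℕ→ℚ n ≤ ℕ→ℚ (card (K ℕ.* N) Ã)) (sym (^-distrib-* K N r))
             (density-transfer c α (K ℕ.^ r) (N ℕ.^ r) classes (card N A) (card (K ℕ.* N) Ã)
               (ℚ.<⇒≤ (1/suc-pos E)) (1/suc*≤1 E) A-dense
               (ℕ.≤-trans A≤classes*Aj (ℕ.*-monoʳ-≤ classes (card≤card-image (colourClass N A j) 1≤N))))

  pddLe : ∀ α → PddLe Q (c * α) P α
  pddLe α β Q-pdd ε ε>0 =
    let N₀ , Q-dense = Q-pdd ε ε>0
    in suc N₀ , λ N N>N₀ A _ A-dense →
      let 1≤N = ℕ.≤-trans (ℕ.s≤s ℕ.z≤n) N>N₀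
          N≤KN = ℕ.m≤n*m N K
          j , Ã-dense = dense-colourClass-image α N A 1≤N A-dense
          Ã = image N (colourClass N A j)
          d′ , d′≢0 , Q-many = Q-dense (K ℕ.* N) (ℕ.≤-trans (ℕ.n≤1+n N₀) (ℕ.≤-trans N>N₀ N≤KN))
                                 Ã (image-⊆-box (colourClass N A j) 1≤N) Ã-dense
      in scale d′ , scale-nonZero d′≢0 ,
         lower-bound-transfer (β - ε) (N ℕ.^ r) ((K ℕ.* N) ℕ.^ r)
           (countPattern (K ℕ.* N) Q Ã d′) (countPattern N P A (scale d′)) Q-many
           (countPattern-transfer N A j d′) (ℕ.^-monoˡ-≤ r N≤KN)

-- Only the left inverse of M and the inclusion φ(P) ⊆ Q are used, and the bound holds for every α.
proposition2p2 : ∀ {r : ℕ} (P Q : List⁺ (Pt r)) →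
    (Σ (Mat r) λ M → Σ (Vec ℚ r) λ b → InvertibleMat M × ImageEq M b P Q) →
    Σ ℚ λ c → 0ℚ < c × c < 1ℚ ×
      (∀ (α : ℚ) → 0ℚ < α → α < 1ℚ → PddLe Q (c * α) P α)
proposition2p2 P Q (M , b , (_ , _ , M′M≡I) , (φP⊆Q , _)) =
  c , 1/suc-pos E , 1/suc<1 E , λ α _ _ → pddLe α
  where open Transfer P Q M b M′M≡I φP⊆Q
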